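{- For all $k\ge1$ and all $n\ge k+1$, the highest power of $x$ appearing in $Q_{n,132}^{(k,0,\emptyset,0)}(x)$ is $x^{n-k}$, and $Q_{n,132}^{(k,0,\emptyset,0)}(x)|_{x^{n-k}}=1$.
   Context: For $\sigma=\sigma_1\cdots\sigma_n\in S_n$, $\mathrm{mmp}^{(k,0,\emptyset,0)}(\sigma)$ is the number of positions $i$ such that there are at least $k$ indices $j>i$ with $\sigma_j>\sigma_i$ and no $j<i$ with $\sigma_j<\sigma_i$. $S_n(132)$ is the set of 132-avoiding permutations of $[n]$. $Q_{n,132}^{(k,0,\emptyset,0)}(x)=\sum_{\sigma\in S_n(132)}x^{\mathrm{mmp}^{(k,0,\emptyset,0)}(\sigma)}$. $P(x)|_{x^r}$ is the coefficient of $x^r$. -}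

module Defs where

open import Data.Nat using (ℕ; zero; suc; _+_; _<ᵇ_; _≤ᵇ_; _≡ᵇ_)
open import Data.Bool using (Bool; true; false; _∧_; _∨_; not; if_then_else_)
open import Data.List using (List; []; _∷_; [_]; _++_; map; concatMap; filterᵇ; length)
open import Data.Bool.ListAction using (any)

-- Permutations of [n] = {1,…,n}, written in one-line notation σ₁⋯σₙ as lists.
-- S n enumerates each permutation exactly once (insert n in every position
-- of every permutation of [n-1]).
insertions : ℕ → List ℕ → List (List ℕ)
insertions x []       = [ x ∷ [] ]
insertions x (y ∷ ys) = (x ∷ y ∷ ys) ∷ map (y ∷_) (insertions x ys)

S : ℕ → List (List ℕ)
S zero    = [] ∷ []
S (suc n) = concatMap (insertions (suc n)) (S n)

-- σ contains 132 iff there are positions i < j < l with σ_i < σ_l < σ_j.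
has132From : ℕ → List ℕ → Bool
has132From x []       = false
has132From x (y ∷ ys) = any (λ z → (x <ᵇ z) ∧ (z <ᵇ y)) ys ∨ has132From x ys

has132 : List ℕ → Bool
has132 []       = false
has132 (x ∷ xs) = has132From x xs ∨ has132 xs

avoids132 : List ℕ → Bool
avoids132 σ = not (has132 σ)

S132 : ℕ → List (List ℕ)
S132 n = filterᵇ avoids132 (S n)

-- mmp^{(k,0,∅,0)}: number of positions i such that at least k indices j > i
-- have σ_j > σ_i, and no index j < i has σ_j < σ_i.
-- (pre = the entries σ_1 … σ_{i-1} to the left of the current position.)
mmpGo : ℕ → List ℕ → List ℕ → ℕ
mmpGo k pre []       = 0
mmpGo k pre (x ∷ xs) =
  (if not (any (λ y → y <ᵇ x) pre) ∧ (k ≤ᵇ length (filterᵇ (λ y → x <ᵇ y) xs))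
   then 1 else 0)
  + mmpGo k (pre ++ [ x ]) xs

mmp : ℕ → List ℕ → ℕ
mmp k σ = mmpGo k [] σ

-- Q_{n,132}^{(k,0,∅,0)}(x)|_{x^r} = #{σ ∈ S_n(132) : mmp(σ) = r}
Qcoeff : ℕ → ℕ → ℕ → ℕ
Qcoeff n k r = length (filterᵇ (λ σ → mmp k σ ≡ᵇ r) (S132 n))

module Submission where

-- Upper bound: a counted position needs k larger entries to its right, so
-- only the first (length − k) positions of any list can count.
-- Uniqueness: S_{n+1} arises by inserting n+1 into each σ ∈ S_n.  Call σ
-- extremal when it avoids 132 and attains the bound.  Exactly one insertion
-- can be extremal, and it is so iff σ is: for k = 0 the one in front (n+1
-- elsewhere sits above the first entry, so not every position counts); for
-- k ≥ 1 the one at the end (every entry gains one larger entry to its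
-- right), while n+1 in front is not counted and, behind a first entry x, the
-- bound forces x below the last entry z, making x, n+1, z a 132-pattern.
-- Hence the count of extremal permutations passes from (n, k) to (n+1, k+1)
-- and from (n, 0) to (n+1, 0), and S_0 gives 1.  The file proves, in order,
-- counting lemmas, facts on mmp and on 132, the shape of the insertions, the
-- two insertion steps, and the counts.

open import Defs
open import Data.Nat using (ℕ; zero; suc; z≤n; s≤s; _+_; _∸_; _≤_; _<_; _<ᵇ_; _≤ᵇ_; _≡ᵇ_)
open import Data.Nat.Properties
  using (<⇒<ᵇ; <ᵇ⇒<; ≤ᵇ⇒≤; ≡ᵇ⇒≡; <⇒≱; <⇒≢; ≤-trans; ≤-refl; ≤-pred; ≤-<-trans; n≤1+n;
         m≤n⇒m≤1+n; 1+n≰n; ∸-monoˡ-≤; +-∸-assoc; m+n≤o⇒n≤o; +-comm; suc-injective; _≤?_; ≰⇒>)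
open import Data.Bool using (Bool; true; false; _∧_; _∨_; not; if_then_else_; T)
open import Data.Bool.Properties using (T-≡; ∧-zeroʳ; ∨-zeroʳ)
open import Data.Bool.ListAction using (any)
open import Data.List using (List; []; _∷_; [_]; _++_; map; concatMap; filterᵇ; length)
open import Data.List.Properties using (length-++; filter-++; length-filter; ++-assoc; map-++)
open import Data.List.Relation.Unary.All as All using (All; []; _∷_)
open import Data.List.Relation.Unary.All.Properties using (++⁺; ++⁻ˡ; ++⁻ʳ; map⁺; concat⁺)
open import Data.List.Relation.Unary.Any as Any using (here; there)
open import Data.List.Relation.Unary.Any.Properties using (any⁺)
open import Data.List.Membership.Propositional using (_∈_)
open import Data.List.Membership.Propositional.Properties using (∈-++⁺ˡ; ∈-++⁺ʳ)
open import Data.Product using (_×_; _,_; Σ)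
open import Data.Empty using (⊥-elim)
open import Function using (Equivalence)
open import Relation.Nullary using (yes; no)
open import Relation.Binary.PropositionalEquality using (_≡_; _≢_; refl; sym; trans; cong; cong₂; subst)
open import Relation.Binary.PropositionalEquality.Properties using (module ≡-Reasoning)

<ᵇ-true : ∀ {a b} → a < b → (a <ᵇ b) ≡ true
<ᵇ-true a<b = Equivalence.to T-≡ (<⇒<ᵇ a<b)

<ᵇ-false : ∀ {a b} → b ≤ a → (a <ᵇ b) ≡ false
<ᵇ-false {a} {b} b≤a with a <ᵇ b in eq
... | false = refl
... | true  = ⊥-elim (<⇒≱ (<ᵇ⇒< a b (Equivalence.from T-≡ eq)) b≤a)

≤ᵇ-true⇒≤ : ∀ {a b} → (a ≤ᵇ b) ≡ true → a ≤ b
≤ᵇ-true⇒≤ {a} {b} eq = ≤ᵇ⇒≤ a b (Equivalence.from T-≡ eq)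

≡ᵇ-true⇒≡ : ∀ {a b} → (a ≡ᵇ b) ≡ true → a ≡ b
≡ᵇ-true⇒≡ {a} {b} eq = ≡ᵇ⇒≡ a b (Equivalence.from T-≡ eq)

≡ᵇ-false : ∀ {a b} → a ≢ b → (a ≡ᵇ b) ≡ false
≡ᵇ-false {a} {b} a≢b with a ≡ᵇ b in eq
... | false = refl
... | true  = ⊥-elim (a≢b (≡ᵇ-true⇒≡ eq))

true≢false : true ≢ false
true≢false ()

∧-false : ∀ a b → (b ≡ true → a ≡ false) → a ∧ b ≡ false
∧-false false b _ = refl
∧-false true true f = f refl
∧-false true false _ = refl

All-last : {A : Set} {P : A → Set} (xs : List A) {z : A} → All P (xs ++ [ z ]) → P z
All-last xs all with ++⁻ʳ xs all
... | pz ∷ [] = pz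

count : {A : Set} → (A → Bool) → List A → ℕ
count p xs = length (filterᵇ p xs)

module _ {A : Set} (p : A → Bool) where

  count-accept : ∀ x xs → p x ≡ true → count p (x ∷ xs) ≡ suc (count p xs)
  count-accept x xs px rewrite px = refl

  count-reject : ∀ x xs → p x ≡ false → count p (x ∷ xs) ≡ count p xs
  count-reject x xs px rewrite px = refl

  count-++ : ∀ xs ys → count p (xs ++ ys) ≡ count p xs + count p ys
  count-++ xs ys = trans (cong length (filter-++ _ xs ys)) (length-++ (filterᵇ p xs))

  count-≤-length : ∀ xs → count p xs ≤ length xs
  count-≤-length = length-filter _

  count-none : ∀ {xs} → All (λ x → p x ≡ false) xs → count p xs ≡ 0
  count-none []         = refl
  count-none {x ∷ xs} (px ∷ pxs) = trans (count-reject x xs px) (count-none pxs)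

  count-full : ∀ xs → length xs ≤ count p xs → All (λ x → p x ≡ true) xs
  count-full []       _ = []
  count-full (x ∷ xs) full with p x in px
  ... | true  = px ∷ count-full xs (≤-pred full)
  ... | false = ⊥-elim (1+n≰n (≤-trans full (count-≤-length xs)))

  count-unique : ∀ {B : Set} (q : B → Bool) as τ bs (σ : B) → p τ ≡ q σ →
                 All (λ x → p x ≡ false) as → All (λ x → p x ≡ false) bs →
                 count p (as ++ τ ∷ bs) ≡ count q [ σ ]
  count-unique q as τ bs σ pτ≡qσ none-as none-bs = begin
    count p (as ++ τ ∷ bs)         ≡⟨ count-++ as (τ ∷ bs) ⟩
    count p as + count p (τ ∷ bs)  ≡⟨ cong (_+ count p (τ ∷ bs)) (count-none none-as) ⟩
    count p (τ ∷ bs)               ≡⟨ singleton ⟩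
    count q [ σ ]                  ∎
    where
    open ≡-Reasoning
    singleton : count p (τ ∷ bs) ≡ count q [ σ ]
    singleton with q σ in qσ
    ... | true  = trans (count-accept τ bs pτ≡qσ) (cong suc (count-none none-bs))
    ... | false = trans (count-reject τ bs pτ≡qσ) (count-none none-bs)

count-filterᵇ : {A : Set} (p q : A → Bool) (xs : List A) →
                count q (filterᵇ p xs) ≡ count (λ x → p x ∧ q x) xs
count-filterᵇ p q []       = refl
count-filterᵇ p q (x ∷ xs) with p x
... | false = count-filterᵇ p q xs
... | true  with q x
...   | true  = cong suc (count-filterᵇ p q xs)
...   | false = count-filterᵇ p q xs

count-concatMap : {A B : Set} {P : A → Set} (f : A → List B) (p : B → Bool) (q : A → Bool) →
                  (∀ {σ} → P σ → count p (f σ) ≡ count q [ σ ]) →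
                  ∀ {L} → All P L → count p (concatMap f L) ≡ count q L
count-concatMap f p q block []                 = refl
count-concatMap f p q block {σ ∷ L} (Pσ ∷ PL) = begin
  count p (f σ ++ concatMap f L)          ≡⟨ count-++ p (f σ) (concatMap f L) ⟩
  count p (f σ) + count p (concatMap f L) ≡⟨ cong₂ _+_ (block Pσ) (count-concatMap f p q block PL) ⟩
  count q [ σ ] + count q L               ≡⟨ sym (count-++ q [ σ ] L) ⟩
  count q (σ ∷ L)                         ∎
  where open ≡-Reasoning

any-member : {A : Set} (f : A → Bool) {ys : List A} {x : A} → x ∈ ys → f x ≡ true → any f ys ≡ true
any-member f x∈ys fx = Equivalence.to T-≡ (any⁺ f (Any.map (λ { refl → Equivalence.from T-≡ fx }) x∈ys))

any-false⇒fails : {A : Set} (f : A → Bool) {ys : List A} {x : A} →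
                  any f ys ≡ false → x ∈ ys → f x ≡ false
any-false⇒fails f {x = x} none x∈ys with f x in fx
... | false = refl
... | true  = ⊥-elim (true≢false (trans (sym (any-member f x∈ys fx)) none))

any-none : {A : Set} (f : A → Bool) {ys : List A} → All (λ y → f y ≡ false) ys → any f ys ≡ false
any-none f []         = refl
any-none f (fy ∷ fys) = cong₂ _∨_ fy (any-none f fys)

any-snoc-fail : {A : Set} (f : A → Bool) (ys : List A) {z : A} → f z ≡ false →
                any f (ys ++ [ z ]) ≡ any f ys
any-snoc-fail f []       fz rewrite fz = refl
any-snoc-fail f (y ∷ ys) fz = cong (f y ∨_) (any-snoc-fail f ys fz)

counted : ℕ → List ℕ → ℕ → List ℕ → Bool
counted k pre x xs = not (any (_<ᵇ x) pre) ∧ (k ≤ᵇ count (x <ᵇ_) xs)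

counted⇒room : ∀ k pre x xs → counted k pre x xs ≡ true → k ≤ count (x <ᵇ_) xs
counted⇒room k pre x xs c with any (_<ᵇ x) pre
... | false = ≤ᵇ-true⇒≤ c

counted⇒minimum : ∀ k pre x xs {p} → counted k pre x xs ≡ true → p ∈ pre → (p <ᵇ x) ≡ false
counted⇒minimum k pre x xs c p∈pre with any (_<ᵇ x) pre in none
... | false = any-false⇒fails (_<ᵇ x) none p∈pre

mmpGo-bound : ∀ k pre xs → mmpGo k pre xs ≤ length xs ∸ k
mmpGo-bound k pre []       = z≤n
mmpGo-bound k pre (x ∷ xs) with counted k pre x xs in c
... | false = ≤-trans (mmpGo-bound k (pre ++ [ x ]) xs) (∸-monoˡ-≤ k (n≤1+n (length xs)))
... | true  = subst (suc (mmpGo k (pre ++ [ x ]) xs) ≤_) (sym (+-∸-assoc 1 k≤len))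
                (s≤s (mmpGo-bound k (pre ++ [ x ]) xs))
  where
  k≤len : k ≤ length xs
  k≤len = ≤-trans (counted⇒room k pre x xs c) (count-≤-length (x <ᵇ_) xs)

mmpGo-tight : ∀ k pre x xs → k ≤ length xs → mmpGo k pre (x ∷ xs) ≡ length (x ∷ xs) ∸ k →
              counted k pre x xs ≡ true × mmpGo k (pre ++ [ x ]) xs ≡ length xs ∸ k
mmpGo-tight k pre x xs k≤len tight with counted k pre x xs in c
... | true  = refl , suc-injective (trans tight (+-∸-assoc 1 k≤len))
... | false = ⊥-elim (1+n≰n (subst (_≤ length xs ∸ k) (trans tight (+-∸-assoc 1 k≤len))
                                   (mmpGo-bound k (pre ++ [ x ]) xs)))

all-counted⇒decreasing : ∀ pre xs {p} → mmpGo 0 pre xs ≡ length xs → p ∈ pre →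
                         All (λ w → (p <ᵇ w) ≡ false) xs
all-counted⇒decreasing pre []       tight p∈pre = []
all-counted⇒decreasing pre (w ∷ ws) tight p∈pre with mmpGo-tight 0 pre w ws z≤n tight
... | c , tight-rest = counted⇒minimum 0 pre w ws c p∈pre
                     ∷ all-counted⇒decreasing (pre ++ [ w ]) ws tight-rest (∈-++⁺ˡ p∈pre)

-- k ≥ 1: if the bound is attained and at least k+1 entries exceed an entry
-- p to the left, then in particular the last entry z exceeds p.  Walking
-- along the list, each entry is either counted (hence below p, so the
-- entries exceeding p all lie behind it) or has fewer than k+1 entries
-- behind it, in which case all remaining entries exceed p.
tight⇒last-exceeds : ∀ k pre t z {p} → p ∈ pre →
                     mmpGo (suc k) pre (t ++ [ z ]) ≡ length (t ++ [ z ]) ∸ suc k →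
                     suc k ≤ count (p <ᵇ_) (t ++ [ z ]) → (p <ᵇ z) ≡ true
tight⇒last-exceeds k pre [] z {p} p∈pre tight many with p <ᵇ z in p<z
... | true  = refl
... | false with () ← many
tight⇒last-exceeds k pre (w ∷ t) z {p} p∈pre tight many with suc k ≤? length (t ++ [ z ])
... | no short = All-last (w ∷ t) (count-full (p <ᵇ_) (w ∷ t ++ [ z ]) (≤-trans (≰⇒> short) many))
... | yes long with mmpGo-tight (suc k) pre w (t ++ [ z ]) long tight
...   | c , tight-rest =
  tight⇒last-exceeds k (pre ++ [ w ]) t z (∈-++⁺ˡ p∈pre) tight-rest
    (subst (suc k ≤_) (count-reject (p <ᵇ_) w (t ++ [ z ]) w-below-p) many)
  where
  w-below-p : (p <ᵇ w) ≡ false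
  w-below-p = counted⇒minimum (suc k) pre w (t ++ [ z ]) c p∈pre

mmpGo-drop-max : ∀ k n pre xs → All (_≤ n) xs → mmpGo k (suc n ∷ pre) xs ≡ mmpGo k pre xs
mmpGo-drop-max k n pre []       []           = refl
mmpGo-drop-max k n pre (x ∷ xs) (x≤n ∷ xs≤n) =
  cong₂ _+_ (cong (λ b → if not (b ∨ any (_<ᵇ x) pre) ∧ (k ≤ᵇ count (x <ᵇ_) xs) then 1 else 0)
                  (<ᵇ-false (m≤n⇒m≤1+n x≤n)))
            (mmpGo-drop-max k n (pre ++ [ x ]) xs xs≤n)

≤ᵇ-suc : ∀ k c → (suc k ≤ᵇ suc c) ≡ (k ≤ᵇ c)
≤ᵇ-suc zero    c = refl
≤ᵇ-suc (suc k) c = refl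

-- An entry n+1 appended to entries ≤ n gives each of them one more larger
-- entry to its right, and is itself never counted for a threshold k+1 ≥ 1.
mmpGo-snoc-max : ∀ k n pre xs → All (_≤ n) xs → mmpGo (suc k) pre (xs ++ [ suc n ]) ≡ mmpGo k pre xs
mmpGo-snoc-max k n pre []       [] =
  cong (λ b → (if b then 1 else 0) + 0) (∧-zeroʳ (not (any (_<ᵇ suc n) pre)))
mmpGo-snoc-max k n pre (x ∷ xs) (x≤n ∷ xs≤n) =
  cong₂ _+_ (cong (λ b → if not (any (_<ᵇ x) pre) ∧ b then 1 else 0) one-more-larger)
            (mmpGo-snoc-max k n (pre ++ [ x ]) xs xs≤n)
  where
  open ≡-Reasoning
  one-more-larger : (suc k ≤ᵇ count (x <ᵇ_) (xs ++ [ suc n ])) ≡ (k ≤ᵇ count (x <ᵇ_) xs)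
  one-more-larger = begin
    suc k ≤ᵇ count (x <ᵇ_) (xs ++ [ suc n ])
      ≡⟨ cong (suc k ≤ᵇ_) (count-++ (x <ᵇ_) xs [ suc n ]) ⟩
    suc k ≤ᵇ (count (x <ᵇ_) xs + count (x <ᵇ_) [ suc n ])
      ≡⟨ cong (λ c → suc k ≤ᵇ (count (x <ᵇ_) xs + c))
              (count-accept (x <ᵇ_) (suc n) [] (<ᵇ-true (s≤s x≤n))) ⟩
    suc k ≤ᵇ (count (x <ᵇ_) xs + 1)
      ≡⟨ cong (suc k ≤ᵇ_) (+-comm (count (x <ᵇ_) xs) 1) ⟩
    suc k ≤ᵇ suc (count (x <ᵇ_) xs)
      ≡⟨ ≤ᵇ-suc k (count (x <ᵇ_) xs) ⟩
    k ≤ᵇ count (x <ᵇ_) xs ∎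

-- A new maximum n+1 in front cannot play the role of the "1" of a 132.
has132From-max : ∀ n ys → All (_≤ n) ys → has132From (suc n) ys ≡ false
has132From-max n []       _            = refl
has132From-max n (y ∷ ys) (_ ∷ ys≤n) =
  cong₂ _∨_ (any-none _ (All.map (λ {z} z≤ → cong (_∧ (z <ᵇ y)) (<ᵇ-false (m≤n⇒m≤1+n z≤))) ys≤n))
            (has132From-max n ys ys≤n)

has132-cons-max : ∀ n σ → All (_≤ n) σ → has132 (suc n ∷ σ) ≡ has132 σ
has132-cons-max n σ σ≤n = cong (_∨ has132 σ) (has132From-max n σ σ≤n)

-- A new maximum n+1 at the end cannot play the role of the "2" of a 132.
has132From-snoc-max : ∀ n x ys → All (_≤ n) ys → has132From x (ys ++ [ suc n ]) ≡ has132From x ys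
has132From-snoc-max n x []       []           = refl
has132From-snoc-max n x (y ∷ ys) (y≤n ∷ ys≤n) =
  cong₂ _∨_ (any-snoc-fail (λ z → (x <ᵇ z) ∧ (z <ᵇ y)) ys
               (trans (cong ((x <ᵇ suc n) ∧_) (<ᵇ-false (m≤n⇒m≤1+n y≤n))) (∧-zeroʳ _)))
            (has132From-snoc-max n x ys ys≤n)

has132-snoc-max : ∀ n σ → All (_≤ n) σ → has132 (σ ++ [ suc n ]) ≡ has132 σ
has132-snoc-max n []       []           = refl
has132-snoc-max n (x ∷ xs) (_ ∷ xs≤n) =
  cong₂ _∨_ (has132From-snoc-max n x xs xs≤n) (has132-snoc-max n xs xs≤n)

has132From-witness : ∀ x y z as bs → (x <ᵇ z) ≡ true → (z <ᵇ y) ≡ true →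
                     has132From x (as ++ y ∷ bs ++ [ z ]) ≡ true
has132From-witness x y z []       bs x<z z<y =
  cong (_∨ has132From x (bs ++ [ z ]))
       (any-member (λ w → (x <ᵇ w) ∧ (w <ᵇ y)) (∈-++⁺ʳ bs (here refl)) (cong₂ _∧_ x<z z<y))
has132From-witness x y z (a ∷ as) bs x<z z<y =
  trans (cong (any (λ v → (x <ᵇ v) ∧ (v <ᵇ a)) (as ++ y ∷ bs ++ [ z ]) ∨_)
              (has132From-witness x y z as bs x<z z<y))
        (∨-zeroʳ _)

Sized : ℕ → List ℕ → Set
Sized n σ = length σ ≡ n × All (_≤ n) σ

insertions-bounded : ∀ m x σ → x ≤ m → All (_≤ m) σ →
                     All (λ τ → length τ ≡ suc (length σ) × All (_≤ m) τ) (insertions x σ)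
insertions-bounded m x []       x≤m []           = (refl , x≤m ∷ []) ∷ []
insertions-bounded m x (y ∷ ys) x≤m (y≤m ∷ ys≤m) =
  (refl , x≤m ∷ y≤m ∷ ys≤m)
  ∷ map⁺ (All.map (λ { (len , τ≤m) → cong suc len , y≤m ∷ τ≤m }) (insertions-bounded m x ys x≤m ys≤m))

insertions-sized : ∀ n {σ} → Sized n σ → All (Sized (suc n)) (insertions (suc n) σ)
insertions-sized n {σ} (refl , σ≤n) =
  insertions-bounded (suc n) (suc n) σ ≤-refl (All.map m≤n⇒m≤1+n σ≤n)

S-sized : ∀ n → All (Sized n) (S n)
S-sized zero    = (refl , []) ∷ []
S-sized (suc n) = concat⁺ (map⁺ (All.map (insertions-sized n) (S-sized n)))

insertions-∈ : ∀ x σ → All (x ∈_) (insertions x σ)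
insertions-∈ x []       = here refl ∷ []
insertions-∈ x (y ∷ ys) = here refl ∷ map⁺ (All.map there (insertions-∈ x ys))

data InsertedBeforeEnd (n : ℕ) : List ℕ → Set where
  inserted : ∀ {as bs z} → All (_≤ n) as → All (_≤ n) bs → z ≤ n →
             InsertedBeforeEnd n (as ++ suc n ∷ bs ++ [ z ])

inserted-cons : ∀ {n y τ} → y ≤ n → InsertedBeforeEnd n τ → InsertedBeforeEnd n (y ∷ τ)
inserted-cons y≤n (inserted as≤n bs≤n last≤n) = inserted (y≤n ∷ as≤n) bs≤n last≤n

last-view : {A : Set} (y : A) (ys : List A) → Σ (List A) λ bs → Σ A λ z → y ∷ ys ≡ bs ++ [ z ]
last-view y []        = [] , y , refl
last-view y (y′ ∷ ys) with last-view y′ ys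
... | bs , z , eq = y ∷ bs , z , cong (y ∷_) eq

insertions-split : ∀ n σ → All (_≤ n) σ →
                   Σ (List (List ℕ)) λ L → insertions (suc n) σ ≡ L ++ [ σ ++ [ suc n ] ]
                                           × All (InsertedBeforeEnd n) L
insertions-split n []       _            = [] , refl , []
insertions-split n (y ∷ ys) (y≤n ∷ ys≤n) with insertions-split n ys ys≤n | last-view y ys
... | L , eq , before | bs , z , y∷ys≡bs∷z =
  (suc n ∷ y ∷ ys) ∷ map (y ∷_) L ,
  cong ((suc n ∷ y ∷ ys) ∷_) (trans (cong (map (y ∷_)) eq) (map-++ (y ∷_) L _)) ,
  front ∷ map⁺ (All.map (inserted-cons y≤n) before)
  where
  bs∷z≤n : All (_≤ n) (bs ++ [ z ])
  bs∷z≤n = subst (All (_≤ n)) y∷ys≡bs∷z (y≤n ∷ ys≤n)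
  last≤n : All (_≤ n) [ z ] → z ≤ n
  last≤n (bound ∷ []) = bound
  front : InsertedBeforeEnd n (suc n ∷ y ∷ ys)
  front = subst (InsertedBeforeEnd n) (cong (suc n ∷_) (sym y∷ys≡bs∷z))
                (inserted [] (++⁻ˡ bs bs∷z≤n) (last≤n (++⁻ʳ bs bs∷z≤n)))

avoidsWithValue : ℕ → ℕ → List ℕ → Bool
avoidsWithValue k r σ = avoids132 σ ∧ (mmp k σ ≡ᵇ r)

Qcoeff-as-count : ∀ n k r → Qcoeff n k r ≡ count (avoidsWithValue k r) (S n)
Qcoeff-as-count n k r = count-filterᵇ avoids132 (λ σ → mmp k σ ≡ᵇ r) (S n)

wrong-value⇒rejected : ∀ k r σ → mmp k σ ≢ r → avoidsWithValue k r σ ≡ false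
wrong-value⇒rejected k r σ ≢r = trans (cong (avoids132 σ ∧_) (≡ᵇ-false ≢r)) (∧-zeroʳ _)

extremal : ℕ → ℕ → List ℕ → Bool
extremal n k = avoidsWithValue k (n ∸ k)

extremal-cons-max₀ : ∀ n σ → All (_≤ n) σ → extremal (suc n) 0 (suc n ∷ σ) ≡ extremal n 0 σ
extremal-cons-max₀ n σ σ≤n =
  cong₂ _∧_ (cong not (has132-cons-max n σ σ≤n))
            (cong (λ m → suc m ≡ᵇ suc n) (mmpGo-drop-max 0 n [] σ σ≤n))

-- … while behind a first entry y ≤ n it sits above y, so not every position counts.
behind-first-rejected₀ : ∀ n y τ → y ≤ n → suc n ∈ τ → length τ ≡ n →
                         extremal (suc n) 0 (y ∷ τ) ≡ false
behind-first-rejected₀ n y τ y≤n n+1∈τ len = wrong-value⇒rejected 0 (suc n) (y ∷ τ) λ tight →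
  let none-above-y = all-counted⇒decreasing [ y ] τ (trans (suc-injective tight) (sym len)) (here refl)
  in true≢false (trans (sym (<ᵇ-true (s≤s y≤n))) (All.lookup none-above-y n+1∈τ))

extremal-snoc-max : ∀ n k σ → All (_≤ n) σ → extremal (suc n) (suc k) (σ ++ [ suc n ]) ≡ extremal n k σ
extremal-snoc-max n k σ σ≤n =
  cong₂ _∧_ (cong not (has132-snoc-max n σ σ≤n))
            (cong (_≡ᵇ n ∸ k) (mmpGo-snoc-max k n [] σ σ≤n))

-- … while any other position is rejected.  In front, n+1 has nothing larger
-- to its right, so it is not counted and the bound is missed …
max-first-rejected : ∀ n k rest → suc k ≤ n → Sized n rest → extremal (suc n) (suc k) (suc n ∷ rest) ≡ false
max-first-rejected n k rest k<n (len , rest≤n) =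
  wrong-value⇒rejected (suc k) (n ∸ k) (suc n ∷ rest) λ tight →
    let counted-n+1 , _ = mmpGo-tight (suc k) [] (suc n) rest k<rest (trans tight (cong (_∸ k) (sym len)))
        room = subst (suc k ≤_) (count-none (suc n <ᵇ_) nothing-above)
                     (counted⇒room (suc k) [] (suc n) rest counted-n+1)
    in 1+n≰n (≤-trans room z≤n)
  where
  k<rest : suc k ≤ length rest
  k<rest = subst (suc k ≤_) (sym len) k<n
  nothing-above : All (λ w → (suc n <ᵇ w) ≡ false) rest
  nothing-above = All.map (λ w≤n → <ᵇ-false (m≤n⇒m≤1+n w≤n)) rest≤n

-- … and behind a first entry x, attaining the bound forces x below the last
-- entry z ≤ n, so that x, n+1, z is a 132-pattern.
max-inside-rejected : ∀ n k x as bs z → suc k ≤ n → length (as ++ suc n ∷ bs ++ [ z ]) ≡ n → z ≤ n →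
                      extremal (suc n) (suc k) (x ∷ as ++ suc n ∷ bs ++ [ z ]) ≡ false
max-inside-rejected n k x as bs z k<n len z≤ =
  ∧-false _ _ λ tight-test →
    let tight = trans (≡ᵇ-true⇒≡ tight-test) (cong (_∸ k) (sym len))
        c , tight-rest = mmpGo-tight (suc k) [] x rest k<rest tight
        x<z = tight⇒last-exceeds k [ x ] (as ++ suc n ∷ bs) z (here refl)
                (subst (λ l → mmpGo (suc k) [ x ] l ≡ length l ∸ suc k) (sym assoc) tight-rest)
                (subst (λ l → suc k ≤ count (x <ᵇ_) l) (sym assoc) (counted⇒room (suc k) [] x rest c))
    in cong (λ b → not (b ∨ has132 rest)) (has132From-witness x (suc n) z as bs x<z (<ᵇ-true (s≤s z≤)))
  where
  rest : List ℕ
  rest = as ++ suc n ∷ bs ++ [ z ]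
  assoc : (as ++ suc n ∷ bs) ++ [ z ] ≡ rest
  assoc = ++-assoc as (suc n ∷ bs) [ z ]
  k<rest : suc k ≤ length rest
  k<rest = subst (suc k ≤_) (sym len) k<n

before-end-rejected : ∀ n k τ → suc k ≤ n → length τ ≡ suc n → InsertedBeforeEnd n τ →
                      extremal (suc n) (suc k) τ ≡ false
before-end-rejected n k _ k<n len (inserted {[]}     [] bs≤n z≤) =
  max-first-rejected n k _ k<n (suc-injective len , ++⁺ bs≤n (z≤ ∷ []))
before-end-rejected n k _ k<n len (inserted {x ∷ as} _  _    z≤) =
  max-inside-rejected n k x as _ _ k<n (suc-injective len) z≤

insertion-step₀ : ∀ n {σ} → Sized n σ →
                  count (extremal (suc n) 0) (insertions (suc n) σ) ≡ count (extremal n 0) [ σ ]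
insertion-step₀ n {[]}     (refl , []) = refl
insertion-step₀ n {y ∷ ys} (len , y≤n ∷ ys≤n) =
  count-unique (extremal (suc n) 0) (extremal n 0)
               [] (suc n ∷ y ∷ ys) (map (y ∷_) (insertions (suc n) ys)) (y ∷ ys)
               (extremal-cons-max₀ n (y ∷ ys) (y≤n ∷ ys≤n)) [] (map⁺ behind-y)
  where
  behind-y : All (λ τ → extremal (suc n) 0 (y ∷ τ) ≡ false) (insertions (suc n) ys)
  behind-y = All.zipWith
    (λ { {τ} (n+1∈τ , (lenτ , _)) → behind-first-rejected₀ n y τ y≤n n+1∈τ (trans lenτ len) })
    (insertions-∈ (suc n) ys , insertions-bounded (suc n) (suc n) ys ≤-refl (All.map m≤n⇒m≤1+n ys≤n))

insertion-step : ∀ n k {σ} → suc k ≤ n → Sized n σ →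
                 count (extremal (suc n) (suc k)) (insertions (suc n) σ) ≡ count (extremal n k) [ σ ]
insertion-step n k {σ} k<n σ-sized@(_ , σ≤n) with insertions-split n σ σ≤n
... | L , split , before-end = begin
  count E (insertions (suc n) σ)      ≡⟨ cong (count E) split ⟩
  count E (L ++ [ σ ++ [ suc n ] ])  ≡⟨ count-unique E (extremal n k) L (σ ++ [ suc n ]) [] σ
                                          (extremal-snoc-max n k σ σ≤n) rejected [] ⟩
  count (extremal n k) [ σ ]         ∎
  where
  open ≡-Reasoning
  E : List ℕ → Bool
  E = extremal (suc n) (suc k)
  L-sized : All (Sized (suc n)) L
  L-sized = ++⁻ˡ L (subst (All (Sized (suc n))) split (insertions-sized n σ-sized))
  rejected : All (λ τ → E τ ≡ false) L
  rejected = All.zipWith (λ { {τ} (shape , (lenτ , _)) → before-end-rejected n k τ k<n lenτ shape })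
                         (before-end , L-sized)

-- The decreasing permutation is the only extremal one for k = 0.
extremal-count₀ : ∀ n → count (extremal n 0) (S n) ≡ 1
extremal-count₀ zero    = refl
extremal-count₀ (suc n) =
  trans (count-concatMap (insertions (suc n)) _ _ (insertion-step₀ n) (S-sized n)) (extremal-count₀ n)

extremal-count : ∀ k n → k ≤ n → count (extremal (suc n) k) (S (suc n)) ≡ 1
extremal-count zero    n       _         = extremal-count₀ (suc n)
extremal-count (suc k) (suc n) (s≤s k≤n) =
  trans (count-concatMap (insertions (suc (suc n))) _ _ (insertion-step (suc n) k (s≤s k≤n)) (S-sized (suc n)))
        (extremal-count k n k≤n)

coefficient-above-bound : ∀ n k r → n ∸ k < r → Qcoeff n k r ≡ 0
coefficient-above-bound n k r bound<r =
  trans (Qcoeff-as-count n k r) (count-none _ (All.map above-bound-rejected (S-sized n)))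
  where
  above-bound-rejected : ∀ {σ} → Sized n σ → avoidsWithValue k r σ ≡ false
  above-bound-rejected {σ} (refl , _) =
    wrong-value⇒rejected k r σ (<⇒≢ (≤-<-trans (mmpGo-bound k [] σ) bound<r))

proposition24 : (k n : ℕ) → 1 ≤ k → k + 1 ≤ n →
    ((r : ℕ) → n ∸ k < r → Qcoeff n k r ≡ 0) × (Qcoeff n k (n ∸ k) ≡ 1)
proposition24 k zero    _ k+1≤0 with () ← m+n≤o⇒n≤o k k+1≤0
proposition24 k (suc n) _ k+1≤1+n =
  coefficient-above-bound (suc n) k ,
  trans (Qcoeff-as-count (suc n) k (suc n ∸ k)) (extremal-count k n k≤n)
  where
  k≤n : k ≤ n
  k≤n = ≤-pred (subst (_≤ suc n) (+-comm k 1) k+1≤1+n)
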